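{- Let $M$ be a map with a single zigzag and edge set $E$. (a) For $x,y\in E$: $y\in i_{\overline{P}}^2(x)$ if and only if $|i_{\overline{P}}(x)\cap i_{\overline{P}}(y)|$ is odd; consequently $x\in i_{\overline{P}}^2(y)$ if and only if $y\in i_{\overline{P}}^2(x)$. (b) For $x\in E$: $x\in b_P(x)$ if and only if $x\in i_{\overline{P}}^2(x)$ if and only if $x\in\mathcal{O}$.
   Context: A map $M$ is a graph $G_M$ with edge set $E=\{1,\dots,n\}$ cellularly embedded in a closed surface; it has a single zigzag (a closed walk alternately taking the leftmost and rightmost continuation at each vertex), which traverses each edge exactly twice, and the cyclic sequence of traversed edges is the Gauss code $\overline{P}$. An edge is black if the zigzag traverses it twice in the same direction, white otherwise. Identify subsets of $E$ with vectors in $\mathbb{Z}_2^E$ and $x$ with $\{x\}$. Linear maps on singletons: $i_{\overline{P}}(x)$ = set of edges occurring exactly once in $\overline{P}$ strictly between the two occurrences of $x$; $\kappa_P(x)=\{x\}$ if $x$ black, $\emptyset$ if white; $c_P=\kappa_P+i_{\overline{P}}$, $c_{P^\sim}=c_P+\mathrm{id}$, $b_P=c_{P^\sim}\circ c_P$. $\mathcal{O}=\{x\in E:|i_{\overline{P}}(x)|\text{ odd}\}$. -}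

module Defs where

open import Data.Nat using (ℕ; zero; suc; _%_)
open import Data.Bool using (Bool; true; false; if_then_else_; _xor_; _∧_; not)
open import Data.Fin using (Fin; _≟_)
open import Data.Fin.Subset using (Subset; ⊥; ⁅_⁆; ∣_∣)
open import Data.List using (List; []; _∷_; map; foldr; allFin; dropWhile; takeWhile)
open import Data.Product using (_×_; _,_; proj₁; proj₂)
open import Data.Vec using (Vec; lookup; tabulate; zipWith)
open import Relation.Nullary using (does; ¬?)
open import Relation.Binary.PropositionalEquality using (_≡_)

-- Edge set E = Fin n.  Subsets of E = vectors in Z₂^E (Subset n = Vec Bool n).

-- Zigzag of a map with a single zigzag, recorded as the (cyclic, cut open at an
-- arbitrary point) sequence P of traversed edges, each entry also carrying the
-- direction (relative to a fixed reference orientation of the edge) in which the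
-- zigzag traverses it.  The Gauss code P̄ is the underlying sequence of edges.
Zigzag : ℕ → Set
Zigzag n = List (Fin n × Bool)

gauss : ∀ {n} → Zigzag n → List (Fin n)
gauss P = map proj₁ P

occ : ∀ {n} → Fin n → List (Fin n) → ℕ
occ y []       = zero
occ y (z ∷ zs) = if does (z ≟ y) then suc (occ y zs) else occ y zs

IsSingleZigzag : ∀ {n} → Zigzag n → Set
IsSingleZigzag {n} P = (x : Fin n) → occ x (gauss P) ≡ 2

_⊕_ : ∀ {n} → Subset n → Subset n → Subset n
_⊕_ = zipWith _xor_

_∈ᵇ_ : ∀ {n} → Fin n → Subset n → Bool
x ∈ᵇ S = lookup S x

odd : ℕ → Bool
odd k = does (Data.Nat._≟_ (k % 2) 1)

lin : ∀ {n} → (Fin n → Subset n) → Subset n → Subset n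
lin {n} f S = foldr (λ x acc → if x ∈ᵇ S then f x ⊕ acc else acc) ⊥ (allFin n)

between : ∀ {n} → Fin n → List (Fin n) → List (Fin n)
between x w with dropWhile (λ z → ¬? (z ≟ x)) w
... | []      = []
... | _ ∷ rest = takeWhile (λ z → ¬? (z ≟ x)) rest

iP : ∀ {n} → Zigzag n → Fin n → Subset n
iP P x = tabulate λ y → does (Data.Nat._≟_ (occ y (between x (gauss P))) 1)

dirs : ∀ {n} → Zigzag n → Fin n → List Bool
dirs [] x = []
dirs ((z , d) ∷ P) x = if does (z ≟ x) then d ∷ dirs P x else dirs P x

black : ∀ {n} → Zigzag n → Fin n → Bool
black P x with dirs P x
... | a ∷ b ∷ [] = not (a xor b)
... | _          = false

κP : ∀ {n} → Zigzag n → Fin n → Subset n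
κP P x = if black P x then ⁅ x ⁆ else ⊥

cP : ∀ {n} → Zigzag n → Fin n → Subset n
cP P x = κP P x ⊕ iP P x

cP∼ : ∀ {n} → Zigzag n → Fin n → Subset n
cP∼ P x = cP P x ⊕ ⁅ x ⁆

bP : ∀ {n} → Zigzag n → Fin n → Subset n
bP P x = lin (cP∼ P) (cP P x)

iP² : ∀ {n} → Zigzag n → Fin n → Subset n
iP² P x = lin (iP P) (iP P x)

𝒪 : ∀ {n} → Zigzag n → Subset n
𝒪 P = tabulate λ x → odd ∣ iP P x ∣

{-# OPTIONS --safe #-}
module Submission where

-- Restricted to two distinct letters y and z, a Gauss code in which every letter occurs
-- twice becomes one of the six words yyzz, yzyz, yzzy, zyyz, zyzy, zzyy, and in each of
-- them y occurs once between the two z's iff z occurs once between the two y's.  So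
-- i_P̄ is a symmetric matrix over Z₂ with zero diagonal: the (x, y) entry of i_P̄² is
-- Σ_z i(x)_z i(y)_z = |i(x) ∩ i(y)| mod 2, and in the expansion of b_P(x) at x the
-- κ-terms only reach the diagonal, where they contribute c ∧ ¬c = 0.

open import Defs
open import Algebra.Bundles using (CommutativeRing)
open import Data.Bool using (Bool; true; false; not; _∧_; _xor_; if_then_else_)
open import Data.Bool.Properties
  using (not-involutive; ∧-inverseʳ; xor-comm; xor-identityʳ; xor-∧-commutativeRing)
open import Data.Fin using (Fin; zero; suc; _≟_)
open import Data.Fin.Patterns using (0F; 1F)
open import Data.Fin.Subset using (Subset; _∈_; _∉_; _∩_; ∣_∣; ⁅_⁆; ⊥)
open import Data.Fin.Subset.Properties using (x∈⁅x⁆; x≢y⇒x∉⁅y⁆; ∩-comm; ∩-idem)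
open import Data.List using (List; []; _∷_; foldr; length; mapMaybe; takeWhile; tabulate; allFin)
open import Data.Maybe using (Maybe; just; nothing; maybe)
open import Data.Nat using (ℕ; zero; suc; _+_)
import Data.Nat as ℕ
open import Data.Nat.Properties using (+-suc)
open import Data.Product using (_×_; _,_)
open import Data.Vec using (lookup; []; _∷_)
open import Data.Vec.Properties
  using (lookup-zipWith; lookup-replicate; lookup∘tabulate; []=⇒lookup; lookup⇒[]=)
open import Function.Base using (_∘_; id)
open import Function.Bundles using (_⇔_; mk⇔)
open import Relation.Binary.PropositionalEquality
  using (_≡_; _≢_; refl; sym; trans; cong; cong₂; ≢-sym; module ≡-Reasoning)
open import Relation.Nullary using (yes; no; does; ¬?; contradiction)

open import Algebra.Properties.Monoid.Sum (CommutativeRing.+-monoid xor-∧-commutativeRing)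
  using (sum; sum-cong-≗)

private variable
  n m : ℕ

odd-suc : ∀ k → odd (suc k) ≡ not (odd k)
odd-suc zero    = refl
odd-suc (suc k) = sym (trans (cong not (odd-suc k)) (not-involutive (odd k)))

odd-∣p∣ : (S : Subset n) → odd ∣ S ∣ ≡ sum (lookup S)
odd-∣p∣ []          = refl
odd-∣p∣ (true ∷ S)  = trans (odd-suc ∣ S ∣) (cong not (odd-∣p∣ S))
odd-∣p∣ (false ∷ S) = odd-∣p∣ S

lookup≡b⇒∈⇔b≡true : {S : Subset n} {x : Fin n} {b : Bool} → lookup S x ≡ b → x ∈ S ⇔ b ≡ true
lookup≡b⇒∈⇔b≡true refl = mk⇔ []=⇒lookup (lookup⇒[]= _ _)

∉⇒lookup≡false : {S : Subset n} {x : Fin n} → x ∉ S → lookup S x ≡ false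
∉⇒lookup≡false {S = S} {x} x∉S with lookup S x in eq
... | true  = contradiction (lookup⇒[]= x S eq) x∉S
... | false = refl

lookup≡⇒∈⇔∈ : {S T : Subset n} {x y : Fin n} → lookup S x ≡ lookup T y → x ∈ S ⇔ y ∈ T
lookup≡⇒∈⇔∈ eq = mk⇔ (λ x∈S → lookup⇒[]= _ _ (trans (sym eq) ([]=⇒lookup x∈S)))
                     (λ y∈T → lookup⇒[]= _ _ (trans eq ([]=⇒lookup y∈T)))

lookup-⁅x⁆-self : (x : Fin n) → lookup ⁅ x ⁆ x ≡ true
lookup-⁅x⁆-self x = []=⇒lookup (x∈⁅x⁆ x)

lookup-⁅y⁆-≢ : {x y : Fin n} → x ≢ y → lookup ⁅ y ⁆ x ≡ false
lookup-⁅y⁆-≢ x≢y = ∉⇒lookup≡false (x≢y⇒x∉⁅y⁆ x≢y)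

foldr-xor-tabulate : {A : Set} (g : A → Bool) (h : Fin m → A) →
  foldr (λ a acc → g a xor acc) false (tabulate h) ≡ sum (g ∘ h)
foldr-xor-tabulate {m = zero}  g h = refl
foldr-xor-tabulate {m = suc m} g h = cong (g (h zero) xor_) (foldr-xor-tabulate g (h ∘ suc))

lookup-foldr-lin : (f : Fin n → Subset n) (S : Subset n) (y : Fin n) (zs : List (Fin n)) →
  lookup (foldr (λ z acc → if z ∈ᵇ S then f z ⊕ acc else acc) ⊥ zs) y
    ≡ foldr (λ z acc → (lookup S z ∧ lookup (f z) y) xor acc) false zs
lookup-foldr-lin f S y []       = lookup-replicate y false
lookup-foldr-lin f S y (z ∷ zs) with lookup S z
... | true  = trans (lookup-zipWith _xor_ y (f z) _)
                    (cong (lookup (f z) y xor_) (lookup-foldr-lin f S y zs))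
... | false = lookup-foldr-lin f S y zs

lookup-lin : (f : Fin n → Subset n) (S : Subset n) (y : Fin n) →
  lookup (lin f S) y ≡ sum (λ z → lookup S z ∧ lookup (f z) y)
lookup-lin {n} f S y =
  trans (lookup-foldr-lin f S y (allFin n)) (foldr-xor-tabulate (λ z → lookup S z ∧ lookup (f z) y) id)

interlaced : Fin n → Fin n → List (Fin n) → Bool
interlaced y z w = does (occ y (between z w) ℕ.≟ 1)

-- f sends a, and nothing else, to b; other letters may be renamed or erased.
Relabels : (Fin n → Maybe (Fin m)) → Fin n → Fin m → Set
Relabels f a b = ∀ u → does (u ≟ a) ≡ maybe (λ v → does (v ≟ b)) false (f u)

module _ {f : Fin n → Maybe (Fin m)} where

  occ-mapMaybe : ∀ {a b} → Relabels f a b → ∀ w → occ a w ≡ occ b (mapMaybe f w)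
  occ-mapMaybe r []      = refl
  occ-mapMaybe {b = b} r (u ∷ w) rewrite r u with f u
  ... | nothing = occ-mapMaybe r w
  ... | just v with does (v ≟ b)
  ...   | true  = cong suc (occ-mapMaybe r w)
  ...   | false = occ-mapMaybe r w

  takeWhile-mapMaybe : ∀ {c d} → Relabels f c d → ∀ w →
    mapMaybe f (takeWhile (λ u → ¬? (u ≟ c)) w) ≡ takeWhile (λ v → ¬? (v ≟ d)) (mapMaybe f w)
  takeWhile-mapMaybe r []      = refl
  takeWhile-mapMaybe {c = c} r (u ∷ w) with u ≟ c | r u
  ... | yes _ | eq with f u | eq
  ...   | nothing | ()
  ...   | just v  | eq′ rewrite sym eq′ = refl
  takeWhile-mapMaybe r (u ∷ w) | no _ | eq with f u | eq
  ...   | nothing | _   = takeWhile-mapMaybe r w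
  ...   | just v  | eq′ rewrite sym eq′ = cong (v ∷_) (takeWhile-mapMaybe r w)

  between-mapMaybe : ∀ {c d} → Relabels f c d → ∀ w →
    mapMaybe f (between c w) ≡ between d (mapMaybe f w)
  between-mapMaybe r []      = refl
  between-mapMaybe {c = c} r (u ∷ w) with u ≟ c | r u
  ... | yes _ | eq with f u | eq
  ...   | nothing | ()
  ...   | just v  | eq′ rewrite sym eq′ = takeWhile-mapMaybe r w
  between-mapMaybe r (u ∷ w) | no _ | eq with f u | eq
  ...   | nothing | _   = between-mapMaybe r w
  ...   | just v  | eq′ rewrite sym eq′ = between-mapMaybe r w

  interlaced-mapMaybe : ∀ {a b c d} → Relabels f a b → Relabels f c d → ∀ w →
    interlaced a c w ≡ interlaced b d (mapMaybe f w)
  interlaced-mapMaybe {b = b} ra rc w = cong (λ k → does (k ℕ.≟ 1))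
    (trans (occ-mapMaybe ra (between _ w)) (cong (occ b) (between-mapMaybe rc w)))

occ-0F+occ-1F≡length : (v : List (Fin 2)) → occ 0F v + occ 1F v ≡ length v
occ-0F+occ-1F≡length []       = refl
occ-0F+occ-1F≡length (0F ∷ v) = cong suc (occ-0F+occ-1F≡length v)
occ-0F+occ-1F≡length (1F ∷ v) =
  trans (+-suc (occ 0F v) (occ 1F v)) (cong suc (occ-0F+occ-1F≡length v))

interlaced-sym₂ : (v : List (Fin 2)) → occ 0F v ≡ 2 → occ 1F v ≡ 2 →
  interlaced 0F 1F v ≡ interlaced 1F 0F v
interlaced-sym₂ v p q =
  words-of-length-4 v (trans (sym (occ-0F+occ-1F≡length v)) (cong₂ _+_ p q)) p q
  where
  words-of-length-4 : (v : List (Fin 2)) → length v ≡ 4 → occ 0F v ≡ 2 → occ 1F v ≡ 2 →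
    interlaced 0F 1F v ≡ interlaced 1F 0F v
  words-of-length-4 (0F ∷ 0F ∷ 1F ∷ 1F ∷ []) _ _  _  = refl
  words-of-length-4 (0F ∷ 1F ∷ 0F ∷ 1F ∷ []) _ _  _  = refl
  words-of-length-4 (0F ∷ 1F ∷ 1F ∷ 0F ∷ []) _ _  _  = refl
  words-of-length-4 (1F ∷ 0F ∷ 0F ∷ 1F ∷ []) _ _  _  = refl
  words-of-length-4 (1F ∷ 0F ∷ 1F ∷ 0F ∷ []) _ _  _  = refl
  words-of-length-4 (1F ∷ 1F ∷ 0F ∷ 0F ∷ []) _ _  _  = refl
  words-of-length-4 (0F ∷ 0F ∷ 0F ∷ 0F ∷ []) _ () _
  words-of-length-4 (0F ∷ 0F ∷ 0F ∷ 1F ∷ []) _ () _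
  words-of-length-4 (0F ∷ 0F ∷ 1F ∷ 0F ∷ []) _ () _
  words-of-length-4 (0F ∷ 1F ∷ 0F ∷ 0F ∷ []) _ () _
  words-of-length-4 (1F ∷ 0F ∷ 0F ∷ 0F ∷ []) _ () _
  words-of-length-4 (0F ∷ 1F ∷ 1F ∷ 1F ∷ []) _ _  ()
  words-of-length-4 (1F ∷ 0F ∷ 1F ∷ 1F ∷ []) _ _  ()
  words-of-length-4 (1F ∷ 1F ∷ 0F ∷ 1F ∷ []) _ _  ()
  words-of-length-4 (1F ∷ 1F ∷ 1F ∷ 0F ∷ []) _ _  ()
  words-of-length-4 (1F ∷ 1F ∷ 1F ∷ 1F ∷ []) _ _  ()

tag : Fin n → Fin n → Fin n → Maybe (Fin 2)
tag y z u with u ≟ y | u ≟ z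
... | yes _ | _     = just 0F
... | no _  | yes _ = just 1F
... | no _  | no _  = nothing

tag-relabels-fst : (y z : Fin n) → Relabels (tag y z) y 0F
tag-relabels-fst y z u with u ≟ y | u ≟ z
... | yes _ | _     = refl
... | no _  | yes _ = refl
... | no _  | no _  = refl

tag-relabels-snd : {y z : Fin n} → y ≢ z → Relabels (tag y z) z 1F
tag-relabels-snd {y = y} {z} y≢z u with u ≟ y | u ≟ z
... | yes refl | yes refl = contradiction refl y≢z
... | yes _    | no _     = refl
... | no _     | yes _    = refl
... | no _     | no _     = refl

interlaced-sym : (w : List (Fin n)) (y z : Fin n) → occ y w ≡ 2 → occ z w ≡ 2 →
  interlaced y z w ≡ interlaced z y w
interlaced-sym w y z p q with y ≟ z
... | yes refl = refl
... | no y≢z = begin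
  interlaced y z w    ≡⟨ interlaced-mapMaybe ry rz w ⟩
  interlaced 0F 1F v  ≡⟨ interlaced-sym₂ v (trans (sym (occ-mapMaybe ry w)) p)
                                           (trans (sym (occ-mapMaybe rz w)) q) ⟩
  interlaced 1F 0F v  ≡⟨ interlaced-mapMaybe rz ry w ⟨
  interlaced z y w    ∎
  where
  open ≡-Reasoning
  v  = mapMaybe (tag y z) w
  ry = tag-relabels-fst y z
  rz = tag-relabels-snd y≢z

occ-takeWhile-≢ : (x : Fin n) (w : List (Fin n)) → occ x (takeWhile (λ u → ¬? (u ≟ x)) w) ≡ 0
occ-takeWhile-≢ x []      = refl
occ-takeWhile-≢ x (u ∷ w) with u ≟ x in eq
... | yes _ = refl
... | no _ rewrite eq = occ-takeWhile-≢ x w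

occ-between-self : (x : Fin n) (w : List (Fin n)) → occ x (between x w) ≡ 0
occ-between-self x []      = refl
occ-between-self x (u ∷ w) with u ≟ x
... | yes _ = occ-takeWhile-≢ x w
... | no _  = occ-between-self x w

lookup-iP : (P : Zigzag n) (x y : Fin n) → lookup (iP P x) y ≡ interlaced y x (gauss P)
lookup-iP P x = lookup∘tabulate _

iP-diag : (P : Zigzag n) (x : Fin n) → lookup (iP P x) x ≡ false
iP-diag P x = trans (lookup-iP P x x) (cong (λ k → does (k ℕ.≟ 1)) (occ-between-self x (gauss P)))

iP-sym : (P : Zigzag n) → IsSingleZigzag P → (x y : Fin n) → lookup (iP P x) y ≡ lookup (iP P y) x
iP-sym P single x y = begin
  lookup (iP P x) y          ≡⟨ lookup-iP P x y ⟩
  interlaced y x (gauss P)   ≡⟨ interlaced-sym (gauss P) y x (single y) (single x) ⟩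
  interlaced x y (gauss P)   ≡⟨ lookup-iP P y x ⟨
  lookup (iP P y) x          ∎
  where open ≡-Reasoning

lookup-iP² : (P : Zigzag n) → IsSingleZigzag P → (x y : Fin n) →
  lookup (iP² P x) y ≡ odd ∣ iP P x ∩ iP P y ∣
lookup-iP² P single x y = begin
  lookup (iP² P x) y
    ≡⟨ lookup-lin (iP P) (iP P x) y ⟩
  sum (λ z → lookup (iP P x) z ∧ lookup (iP P z) y)
    ≡⟨ sum-cong-≗ (λ z → cong (lookup (iP P x) z ∧_) (iP-sym P single z y)) ⟩
  sum (λ z → lookup (iP P x) z ∧ lookup (iP P y) z)
    ≡⟨ sum-cong-≗ (λ z → lookup-zipWith _∧_ z (iP P x) (iP P y)) ⟨
  sum (lookup (iP P x ∩ iP P y))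
    ≡⟨ odd-∣p∣ (iP P x ∩ iP P y) ⟨
  odd ∣ iP P x ∩ iP P y ∣
    ∎
  where open ≡-Reasoning

iP²-sym : (P : Zigzag n) → IsSingleZigzag P → (x y : Fin n) →
  lookup (iP² P y) x ≡ lookup (iP² P x) y
iP²-sym P single x y = begin
  lookup (iP² P y) x       ≡⟨ lookup-iP² P single y x ⟩
  odd ∣ iP P y ∩ iP P x ∣  ≡⟨ cong (odd ∘ ∣_∣) (∩-comm (iP P y) (iP P x)) ⟩
  odd ∣ iP P x ∩ iP P y ∣  ≡⟨ lookup-iP² P single x y ⟨
  lookup (iP² P x) y       ∎
  where open ≡-Reasoning

lookup-iP²-diag : (P : Zigzag n) → IsSingleZigzag P → (x : Fin n) →
  lookup (iP² P x) x ≡ lookup (𝒪 P) x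
lookup-iP²-diag P single x = begin
  lookup (iP² P x) x       ≡⟨ lookup-iP² P single x x ⟩
  odd ∣ iP P x ∩ iP P x ∣  ≡⟨ cong (odd ∘ ∣_∣) (∩-idem (iP P x)) ⟩
  odd ∣ iP P x ∣           ≡⟨ lookup∘tabulate (λ z → odd ∣ iP P z ∣) x ⟨
  lookup (𝒪 P) x           ∎
  where open ≡-Reasoning

module _ (P : Zigzag n) where

  lookup-κP-≢ : {x z : Fin n} → z ≢ x → lookup (κP P x) z ≡ false
  lookup-κP-≢ {x} {z} z≢x with black P x
  ... | true  = lookup-⁅y⁆-≢ z≢x
  ... | false = lookup-replicate z false

  lookup-cP-≢ : {x z : Fin n} → z ≢ x → lookup (cP P x) z ≡ lookup (iP P x) z
  lookup-cP-≢ {x} {z} z≢x =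
    trans (lookup-zipWith _xor_ z (κP P x) (iP P x)) (cong (_xor lookup (iP P x) z) (lookup-κP-≢ z≢x))

  lookup-cP∼-≢ : {x z : Fin n} → z ≢ x → lookup (cP∼ P x) z ≡ lookup (iP P x) z
  lookup-cP∼-≢ {x} {z} z≢x = begin
    lookup (cP∼ P x) z                          ≡⟨ lookup-zipWith _xor_ z (cP P x) ⁅ x ⁆ ⟩
    lookup (cP P x) z xor lookup ⁅ x ⁆ z        ≡⟨ cong₂ _xor_ (lookup-cP-≢ z≢x) (lookup-⁅y⁆-≢ z≢x) ⟩
    lookup (iP P x) z xor false                 ≡⟨ xor-identityʳ _ ⟩
    lookup (iP P x) z                           ∎
    where open ≡-Reasoning

  lookup-cP∼-diag : (x : Fin n) → lookup (cP∼ P x) x ≡ not (lookup (cP P x) x)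
  lookup-cP∼-diag x = begin
    lookup (cP∼ P x) x                    ≡⟨ lookup-zipWith _xor_ x (cP P x) ⁅ x ⁆ ⟩
    lookup (cP P x) x xor lookup ⁅ x ⁆ x  ≡⟨ cong (lookup (cP P x) x xor_) (lookup-⁅x⁆-self x) ⟩
    lookup (cP P x) x xor true            ≡⟨ xor-comm _ true ⟩
    not (lookup (cP P x) x)               ∎
    where open ≡-Reasoning

  cP∧cP∼≡iP∧iP : (x z : Fin n) →
    lookup (cP P x) z ∧ lookup (cP∼ P z) x ≡ lookup (iP P x) z ∧ lookup (iP P z) x
  cP∧cP∼≡iP∧iP x z with z ≟ x
  ... | no z≢x   = cong₂ _∧_ (lookup-cP-≢ z≢x) (lookup-cP∼-≢ (≢-sym z≢x))
  ... | yes refl = begin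
    lookup (cP P x) x ∧ lookup (cP∼ P x) x        ≡⟨ cong (lookup (cP P x) x ∧_) (lookup-cP∼-diag x) ⟩
    lookup (cP P x) x ∧ not (lookup (cP P x) x)   ≡⟨ ∧-inverseʳ (lookup (cP P x) x) ⟩
    false                                         ≡⟨ cong (λ b → b ∧ b) (iP-diag P x) ⟨
    lookup (iP P x) x ∧ lookup (iP P x) x         ∎
    where open ≡-Reasoning

  lookup-bP-diag : (x : Fin n) → lookup (bP P x) x ≡ lookup (iP² P x) x
  lookup-bP-diag x = begin
    lookup (bP P x) x                                   ≡⟨ lookup-lin (cP∼ P) (cP P x) x ⟩
    sum (λ z → lookup (cP P x) z ∧ lookup (cP∼ P z) x)  ≡⟨ sum-cong-≗ (cP∧cP∼≡iP∧iP x) ⟩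
    sum (λ z → lookup (iP P x) z ∧ lookup (iP P z) x)   ≡⟨ lookup-lin (iP P) (iP P x) x ⟨
    lookup (iP² P x) x                                  ∎
    where open ≡-Reasoning

proposition6 : (n : ℕ) (P : Zigzag n) → IsSingleZigzag P →
    ((x y : Fin n) → (y ∈ iP² P x ⇔ odd ∣ iP P x ∩ iP P y ∣ ≡ true)
                     × (x ∈ iP² P y ⇔ y ∈ iP² P x))
    × ((x : Fin n) → (x ∈ bP P x ⇔ x ∈ iP² P x) × (x ∈ iP² P x ⇔ x ∈ 𝒪 P))
proposition6 n P single =
    (λ x y → lookup≡b⇒∈⇔b≡true (lookup-iP² P single x y) , lookup≡⇒∈⇔∈ (iP²-sym P single x y))
  , (λ x → lookup≡⇒∈⇔∈ (lookup-bP-diag P x) , lookup≡⇒∈⇔∈ (lookup-iP²-diag P single x))
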